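{- Let $\mathcal{X}$ be a finite proper $n$-edge-coloured graph with colour set $I=\{0,\dots,n-1\}$. For $i\in I$ let $\rho_i$ be the permutation of the vertices of $\mathcal{X}$ induced by the edges of colour $i$, let $G=\langle\rho_i:i\in I\rangle$, and for $i,j\in I$ let $G_i=\langle\rho_k:k\in I\setminus\{i\}\rangle$ and $G_{i,j}=\langle\rho_k:k\in I\setminus\{i,j\}\rangle$. Assume that for every $i\in I$ the group $G_i$ (with generators $\rho_k$, $k\ne i$) satisfies the intersection property. If for every $i,j\in I$ there exists a vertex $x$ of $\mathcal{X}$ such that $$|xG_i\cap xG_j|\cdot|\mathrm{Stab}_{G_i}(x)\cap\mathrm{Stab}_{G_j}(x)|\le |G_{i,j}|,$$ then $G$ satisfies the intersection property. In particular, the displayed condition holds for a vertex $x$ whenever $$|xG_i\cap xG_j|\cdot\gcd\big(|\mathrm{Stab}_{G_i}(x)|,|\mathrm{Stab}_{G_j}(x)|\big)\le|G_{i,j}|.$$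
   Context: A proper $n$-edge-coloured graph is a (multi)graph whose edges are coloured with colours in $I=\{0,\dots,n-1\}$ such that, for each $i\in I$, the edges of colour $i$ form a non-empty matching $M_i$, and $M_i\neq M_j$ for $i\neq j$. The permutation $\rho_i$ induced by colour $i$ swaps the two endpoints of each edge of $M_i$ and fixes all vertices not covered by $M_i$; it is an involution. For a vertex $x$ and subgroup $H$, $xH$ denotes the orbit of $x$ under $H$ and $\mathrm{Stab}_H(x)$ its stabiliser. A group $G=\langle\rho_i:i\in I\rangle$ generated by involutions satisfies the intersection property (is a C-group) if $G_J\cap G_K=G_{J\cap K}$ for all $J,K\subseteq I$, where $G_J=\langle\rho_j:j\in J\rangle$ (and $G_\emptyset$ is trivial). -}

module Defs where

open import Data.Nat using (ℕ; _*_; _≤_)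
open import Data.Fin using (Fin)
open import Data.Fin.Subset using (Subset; ∁; ⁅_⁆; _∪_; _∩_; _⊆_; ⊤) renaming (_∈_ to _∈ₛ_)
open import Data.List using (List; []; _∷_; length)
open import Data.List.Relation.Unary.All using (All)
open import Data.List.Relation.Unary.Any using (Any)
open import Data.List.Relation.Unary.AllPairs using (AllPairs)
open import Data.Product using (Σ; ∃; _×_)
open import Relation.Binary.PropositionalEquality using (_≡_; _≢_)
open import Relation.Nullary using (¬_)

-- A finite proper n-edge-coloured graph on vertex set Fin m, given by the
-- permutations ρ i induced by its colour classes: colour class i is a
-- matching M_i, i.e. ρ i is an involution (edges = pairs {x , ρ i x} with
-- x ≠ ρ i x); M_i non-empty  ⇔  ρ i moves some vertex;
-- M_i ≠ M_j  ⇔  ρ i ≠ ρ j.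
record ProperEdgeColouredGraph (n m : ℕ) : Set where
  field
    ρ        : Fin n → Fin m → Fin m
    invol    : ∀ i x → ρ i (ρ i x) ≡ x
    nonempty : ∀ i → ∃ λ x → ρ i x ≢ x
    distinct : ∀ i j → i ≢ j → ∃ λ x → ρ i x ≢ ρ j x

Perm : ℕ → Set
Perm m = Fin m → Fin m

_≈_ : ∀ {m} → Perm m → Perm m → Set
f ≈ g = ∀ x → f x ≡ g x

HasSizeV : ∀ {m} → (Fin m → Set) → ℕ → Set
HasSizeV {m} P k = Σ (List (Fin m)) λ l →
  length l ≡ k × AllPairs _≢_ l × All P l × (∀ y → P y → Any (y ≡_) l)

HasSizeP : ∀ {m} → (Perm m → Set) → ℕ → Set
HasSizeP {m} P k = Σ (List (Perm m)) λ l →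
  length l ≡ k × AllPairs (λ f g → ¬ (f ≈ g)) l × All P l × (∀ f → P f → Any (f ≈_) l)

module _ {n m : ℕ} (X : ProperEdgeColouredGraph n m) where
  open ProperEdgeColouredGraph X

  -- product of generators along a word (apply first letter first)
  word : List (Fin n) → Perm m
  word []      x = x
  word (k ∷ w) x = word w (ρ k x)

  InGen : Subset n → Perm m → Set
  InGen J f = Σ (List (Fin n)) λ w → All (_∈ₛ J) w × (f ≈ word w)

  IntersectionProperty : Subset n → Set
  IntersectionProperty S = ∀ J K → J ⊆ S → K ⊆ S →
    ∀ f → InGen J f → InGen K f → InGen (J ∩ K) f

  Iminus : Fin n → Subset n
  Iminus i = ∁ ⁅ i ⁆

  Iminus2 : Fin n → Fin n → Subset n
  Iminus2 i j = ∁ (⁅ i ⁆ ∪ ⁅ j ⁆)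

  InOrbit : Subset n → Fin m → Fin m → Set
  InOrbit S x y = ∃ λ f → InGen S f × f x ≡ y

  InStab : Subset n → Fin m → Perm m → Set
  InStab S x f = InGen S f × f x ≡ x

  OrbitInter : Fin n → Fin n → Fin m → Fin m → Set
  OrbitInter i j x y = InOrbit (Iminus i) x y × InOrbit (Iminus j) x y

  StabInter : Fin n → Fin n → Fin m → Perm m → Set
  StabInter i j x f = InStab (Iminus i) x f × InStab (Iminus j) x f

  Condition : Fin n → Fin n → Fin m → Set
  Condition i j x = Σ ℕ λ a → Σ ℕ λ b → Σ ℕ λ c →
    HasSizeV (OrbitInter i j x) a × HasSizeP (StabInter i j x) b ×
    HasSizeP (InGen (Iminus2 i j)) c × a * b ≤ c

-- The main point is the equality G_i ∩ G_j = G_{i,j}.  For H = G_i ∩ G_j the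
-- orbit-stabiliser argument gives |H| ≤ |xH| · |Stab_H(x)| ≤ |xG_i ∩ xG_j| ·
-- |Stab_{G_i}(x) ∩ Stab_{G_j}(x)|, so the hypothesis forces |H| ≤ |G_{i,j}|, and
-- since G_{i,j} ≤ H the two groups coincide.  Given J, K ⊆ I with i ∉ J and j ∉ K,
-- an element of G_J ∩ G_K then lies in G_{i,j}, and the intersection property of
-- G_i (for J and I∖{i,j}) followed by that of G_j (for J ∩ I∖{i,j} and K) puts it in
-- G_{J∩K}.  The gcd criterion is Lagrange's theorem: Stab_{G_i}(x) ∩ Stab_{G_j}(x)
-- is a subgroup of both stabilisers, so its order divides both of their orders.
module Submission where

open import Defs
open import Level using (0ℓ)
open import Function using (id; _∘_)
open import Data.Nat using (ℕ; suc; _+_; _*_; _≤_; z≤n; s≤s; NonZero; >-nonZero; ≢-nonZero; ≢-nonZero⁻¹)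
open import Data.Nat.Properties using (≤-refl; ≤-trans; +-suc; ≤-antisym; 1+n≰n; *-monoʳ-≤)
open import Data.Nat.Divisibility using (_∣_; _∣0; ∣-refl; ∣m∣n⇒∣m+n; ∣⇒≤)
open import Data.Nat.GCD using (gcd; gcd-greatest; gcd[m,n]≢0)
open import Data.Fin using (Fin; _≟_)
import Data.Fin.Properties as Fin
open import Data.Fin.Subset using (Subset; ⊤; ∁; ⁅_⁆; _∪_)
  renaming (_∩_ to _∩ₛ_; _⊆_ to _⊆ₛ_; _∈_ to _∈ₛ_)
open import Data.Fin.Subset.Properties
  using (_∈?_; x∉p⇒x∈∁p; x∈⁅y⁆⇒x≡y; p⊆q⇒∁p⊇∁q; p⊆p∪q; q⊆p∪q; p∩q⊆p; p∩q⊆q; x∈p∩q⁺)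
open import Data.List using (List; []; _∷_; length; filter; _++_; map; reverse; cartesianProductWith)
open import Data.List.Properties
  using (length-removeAt′; length-filter; filter-reject; length-++; length-map; unfold-reverse; reverse-involutive)
open import Data.List.Relation.Unary.All using (All; []; _∷_; lookupₛ; lookupAny)
import Data.List.Relation.Unary.All as All
import Data.List.Relation.Unary.All.Properties as All
open import Data.List.Relation.Unary.Any using (Any; here; there; _─_; any?)
import Data.List.Relation.Unary.Any as Any
import Data.List.Relation.Unary.Any.Properties as Any
open import Data.List.Relation.Unary.AllPairs using (_∷_)
open import Data.List.Membership.Propositional using () renaming (_∈_ to _∈ₚ_)
import Data.List.Membership.Setoid as Membership
import Data.List.Membership.Setoid.Properties as MembershipProperties
import Data.List.Relation.Unary.Unique.Setoid as Unique
import Data.List.Relation.Unary.Unique.Setoid.Properties as UniqueProperties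
import Data.List.Relation.Binary.Subset.Setoid as Subset
open import Data.Product using (∃; _×_; _,_; proj₁; proj₂)
open import Data.Sum using (_⊎_; inj₁; inj₂)
open import Relation.Binary.Bundles using (Setoid)
open import Relation.Binary.Core using (Rel; _⇒_)
open import Relation.Binary.Structures using (IsEquivalence)
open import Relation.Binary.Definitions using (Decidable; _Respects_)
open import Relation.Binary.PropositionalEquality using (_≡_)
import Relation.Binary.PropositionalEquality as ≡
open import Relation.Nullary using (¬_; yes; no; ¬?; contradiction)
open import Relation.Nullary.Decidable using (decidable-stable)
open import Relation.Unary using (Pred; _∩_; _⊆_)
import Relation.Unary as U
open import Relation.Unary.Properties using (∁?)

length-filter-∁ : ∀ {a p} {A : Set a} {P : Pred A p} (P? : U.Decidable P) xs →
                  length (filter P? xs) + length (filter (∁? P?) xs) ≡ length xs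
length-filter-∁ P? []       = ≡.refl
length-filter-∁ P? (x ∷ xs) with P? x
... | yes _ = ≡.cong suc (length-filter-∁ P? xs)
... | no  _ = ≡.trans (+-suc _ _) (≡.cong suc (length-filter-∁ P? xs))

length-cartesianProductWith : ∀ {a b c} {A : Set a} {B : Set b} {C : Set c} (f : A → B → C) xs ys →
                              length (cartesianProductWith f xs ys) ≡ length xs * length ys
length-cartesianProductWith f []       ys = ≡.refl
length-cartesianProductWith f (x ∷ xs) ys =
  ≡.trans (length-++ (map (f x) ys)) (≡.cong₂ _+_ (length-map (f x) ys) (length-cartesianProductWith f xs ys))

module Counting {c ℓ} (S : Setoid c ℓ) where
  open Setoid S renaming (_≈_ to _≈ₛ_)
  open Membership S using (_∈_)
  open Unique S using (Unique)
  open Subset S renaming (_⊆_ to _⊆ₗ_)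

  ∈-─⁺ : ∀ {x y xs} (x∈xs : x ∈ xs) → y ∈ xs → ¬ x ≈ₛ y → y ∈ (xs ─ x∈xs)
  ∈-─⁺ (here x≈z)   (here y≈z)   x≉y = contradiction (trans x≈z (sym y≈z)) x≉y
  ∈-─⁺ (here _)     (there y∈xs) _   = y∈xs
  ∈-─⁺ (there _)    (here y≈z)   _   = here y≈z
  ∈-─⁺ (there x∈xs) (there y∈xs) x≉y = there (∈-─⁺ x∈xs y∈xs x≉y)

  unique-⊆⇒length-≤ : ∀ {xs ys} → Unique xs → xs ⊆ₗ ys → length xs ≤ length ys
  unique-⊆⇒length-≤ {[]}          _            _     = z≤n
  unique-⊆⇒length-≤ {x ∷ xs} {ys} (x≉xs ∷ xs!) xs⊆ys =
    ≡.subst (suc (length xs) ≤_) (≡.sym (length-removeAt′ ys _))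
      (s≤s (unique-⊆⇒length-≤ xs! λ y∈xs → ∈-─⁺ x∈ys (xs⊆ys (there y∈xs)) (x≉ y∈xs)))
    where
    x∈ys = xs⊆ys (here refl)
    x≉ : ∀ {y} → y ∈ xs → ¬ x ≈ₛ y
    x≉ y∈xs x≈y = MembershipProperties.All[≉]⇒∉ S x≉xs (MembershipProperties.∈-resp-≈ S (sym x≈y) y∈xs)

  unique-⊆-⊇⇒length-≡ : ∀ {xs ys} → Unique xs → Unique ys → xs ⊆ₗ ys → ys ⊆ₗ xs →
                        length xs ≡ length ys
  unique-⊆-⊇⇒length-≡ xs! ys! xs⊆ys ys⊆xs =
    ≤-antisym (unique-⊆⇒length-≤ xs! xs⊆ys) (unique-⊆⇒length-≤ ys! ys⊆xs)

  unique-maximal⇒complete : Decidable _≈ₛ_ → ∀ {p} {P : Pred Carrier p} {xs} → Unique xs → All P xs →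
                            (∀ {ys} → Unique ys → All P ys → length ys ≤ length xs) →
                            ∀ {y} → P y → y ∈ xs
  unique-maximal⇒complete _≟_ {xs = xs} xs! pxs maximal {y} py with any? (y ≟_) xs
  ... | yes y∈xs = y∈xs
  ... | no  y∉xs = contradiction (maximal (MembershipProperties.∉⇒All[≉] S y∉xs ∷ xs!) (py ∷ pxs)) 1+n≰n

  module Classes {ℓ′} {_~_ : Rel Carrier ℓ′} (~-isEquivalence : IsEquivalence _~_)
                 (≈⇒~ : _≈ₛ_ ⇒ _~_) (_~?_ : Decidable _~_) where
    private module E = IsEquivalence ~-isEquivalence

    class others : Carrier → List Carrier → List Carrier
    class  k = filter (_~? k)
    others k = filter (∁? (_~? k))

    ClassesOfSize : ℕ → List Carrier → Set _
    ClassesOfSize b xs = ∀ {k} → k ∈ xs → length (class k xs) ≡ b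

    private
      ~-respˡ : ∀ {k} → (_~ k) Respects _≈ₛ_
      ~-respˡ x≈y x~k = E.trans (≈⇒~ (sym x≈y)) x~k

      ≁-respˡ : ∀ {k} → U.∁ (_~ k) Respects _≈ₛ_
      ≁-respˡ x≈y x≁k y~k = x≁k (~-respˡ (sym x≈y) y~k)

    ∈-class⁺ : ∀ {y} k xs → y ∈ xs → y ~ k → y ∈ class k xs
    ∈-class⁺ k _ = MembershipProperties.∈-filter⁺ S (_~? k) ~-respˡ

    ∈-class⁻ : ∀ {y} k xs → y ∈ class k xs → y ∈ xs × y ~ k
    ∈-class⁻ k _ = MembershipProperties.∈-filter⁻ S (_~? k) ~-respˡ

    ∈-others⁺ : ∀ {y} k xs → y ∈ xs → ¬ y ~ k → y ∈ others k xs
    ∈-others⁺ k _ = MembershipProperties.∈-filter⁺ S (∁? (_~? k)) ≁-respˡ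

    ∈-others⁻ : ∀ {y} k xs → y ∈ others k xs → y ∈ xs × ¬ y ~ k
    ∈-others⁻ k _ = MembershipProperties.∈-filter⁻ S (∁? (_~? k)) ≁-respˡ

    class-unique : ∀ {xs} k → Unique xs → Unique (class k xs)
    class-unique k = UniqueProperties.filter⁺ S (_~? k)

    others-unique : ∀ {xs} k → Unique xs → Unique (others k xs)
    others-unique k = UniqueProperties.filter⁺ S (∁? (_~? k))

    classesOfSize-others : ∀ {b xs} k → Unique xs → ClassesOfSize b xs → ClassesOfSize b (others k xs)
    classesOfSize-others {b} {xs} k xs! classes {k′} k′∈others =
      ≡.trans (unique-⊆-⊇⇒length-≡ (class-unique k′ (others-unique k xs!)) (class-unique k′ xs!) narrower wider)
              (classes (proj₁ (∈-others⁻ k xs k′∈others)))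
      where
      narrower : class k′ (others k xs) ⊆ₗ class k′ xs
      narrower y∈ = let y∈others , y~k′ = ∈-class⁻ k′ (others k xs) y∈ in
        ∈-class⁺ k′ xs (proj₁ (∈-others⁻ k xs y∈others)) y~k′
      wider : class k′ xs ⊆ₗ class k′ (others k xs)
      wider y∈ = let y∈xs , y~k′ = ∈-class⁻ k′ xs y∈ in
        ∈-class⁺ k′ (others k xs)
          (∈-others⁺ k xs y∈xs λ y~k → proj₂ (∈-others⁻ k xs k′∈others) (E.trans (E.sym y~k′) y~k)) y~k′

    classesOfSize⇒∣length : ∀ {b xs} → Unique xs → ClassesOfSize b xs → b ∣ length xs
    classesOfSize⇒∣length {b} {xs} = go (length xs) xs ≤-refl
      where
      -- recursion on a length bound: others k xs is not a structural subterm of xs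
      go : ∀ n xs → length xs ≤ n → Unique xs → ClassesOfSize b xs → b ∣ length xs
      go _       []       _            _   _       = b ∣0
      go (suc n) (k ∷ xs) (s≤s |xs|≤n) xs! classes =
        ≡.subst (b ∣_) (length-filter-∁ (_~? k) (k ∷ xs)) (∣m∣n⇒∣m+n b∣|class| b∣|others|)
        where
        |others|≤n : length (others k (k ∷ xs)) ≤ n
        |others|≤n = ≡.subst (λ ys → length ys ≤ n) (≡.sym (filter-reject (∁? (_~? k)) (λ k≁k → k≁k E.refl)))
                       (≤-trans (length-filter _ xs) |xs|≤n)
        b∣|class| : b ∣ length (class k (k ∷ xs))
        b∣|class| = ≡.subst (b ∣_) (≡.sym (classes (here refl))) ∣-refl
        b∣|others| : b ∣ length (others k (k ∷ xs))
        b∣|others| = go n _ |others|≤n (others-unique k xs!) (classesOfSize-others k xs! classes)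

Perm-setoid : ℕ → Setoid 0ℓ 0ℓ
Perm-setoid m = record
  { Carrier       = Perm m
  ; _≈_           = _≈_
  ; isEquivalence = record
    { refl  = λ _ → ≡.refl
    ; sym   = λ f≈g z → ≡.sym (f≈g z)
    ; trans = λ f≈g g≈h z → ≡.trans (f≈g z) (g≈h z)
    }
  }

_≈?_ : ∀ {m} → Decidable (_≈_ {m})
f ≈? g = Fin.all? λ z → f z ≟ g z

-- Perm m also contains non-bijective maps, so inverses are part of the data of a subgroup.
record IsSubgroup {m} (H : Pred (Perm m) 0ℓ) : Set where
  field
    resp           : H Respects _≈_
    id-closed      : H id
    ∘-closed       : ∀ {f g} → H f → H g → H (g ∘ f)
    inverse        : ∀ {f} → H f → Perm m
    inverse-closed : ∀ {f} (hf : H f) → H (inverse hf)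
    inverseˡ       : ∀ {f} (hf : H f) → (inverse hf ∘ f) ≈ id
    inverseʳ       : ∀ {f} (hf : H f) → (f ∘ inverse hf) ≈ id

inverse-unique : ∀ {m} {f g g′ : Perm m} → (g ∘ f) ≈ id → (f ∘ g′) ≈ id → g ≈ g′
inverse-unique {g = g} {g′} gf≈id fg′≈id z = ≡.trans (≡.cong g (≡.sym (fg′≈id z))) (gf≈id (g′ z))

∩-isSubgroup : ∀ {m} {H K : Pred (Perm m) 0ℓ} → IsSubgroup H → IsSubgroup K → IsSubgroup (H ∩ K)
∩-isSubgroup H-sub K-sub = record
  { resp           = λ f≈g (hf , kf) → H.resp f≈g hf , K.resp f≈g kf
  ; id-closed      = H.id-closed , K.id-closed
  ; ∘-closed       = λ (hf , kf) (hg , kg) → H.∘-closed hf hg , K.∘-closed kf kg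
  ; inverse        = λ (hf , _) → H.inverse hf
  ; inverse-closed = λ {f} (hf , kf) →
      H.inverse-closed hf , K.resp (inverse-unique {f = f} (K.inverseˡ kf) (H.inverseʳ hf)) (K.inverse-closed kf)
  ; inverseˡ       = λ (hf , _) → H.inverseˡ hf
  ; inverseʳ       = λ (hf , _) → H.inverseʳ hf
  }
  where module H = IsSubgroup H-sub
        module K = IsSubgroup K-sub

Stabiliser : ∀ {m} → Pred (Perm m) 0ℓ → Fin m → Pred (Perm m) 0ℓ
Stabiliser H x f = H f × f x ≡ x

stabiliser-isSubgroup : ∀ {m} {H : Pred (Perm m) 0ℓ} → IsSubgroup H → ∀ x → IsSubgroup (Stabiliser H x)
stabiliser-isSubgroup H-sub x = record
  { resp           = λ f≈g (hf , fx≡x) → H.resp f≈g hf , ≡.trans (≡.sym (f≈g x)) fx≡x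
  ; id-closed      = H.id-closed , ≡.refl
  ; ∘-closed       = λ {_} {g} (hf , fx≡x) (hg , gx≡x) → H.∘-closed hf hg , ≡.trans (≡.cong g fx≡x) gx≡x
  ; inverse        = λ (hf , _) → H.inverse hf
  ; inverse-closed = λ (hf , fx≡x) →
      H.inverse-closed hf , ≡.trans (≡.cong (H.inverse hf) (≡.sym fx≡x)) (H.inverseˡ hf x)
  ; inverseˡ       = λ (hf , _) → H.inverseˡ hf
  ; inverseʳ       = λ (hf , _) → H.inverseʳ hf
  }
  where module H = IsSubgroup H-sub

module LeftCosets {m} {K : Pred (Perm m) 0ℓ} (K-sub : IsSubgroup K) (LK : List (Perm m))
                  (LK⊆K : All K LK) (K⊆LK : ∀ f → K f → Any (f ≈_) LK) where
  private
    module K = IsSubgroup K-sub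
    S = Perm-setoid m
    open Setoid S using (sym)
    open Membership S using (_∈_)

  coset : Perm m → List (Perm m)
  coset g = map (g ∘_) LK

  ∈-coset⁺ : ∀ {f q} g → K q → f ≈ (g ∘ q) → f ∈ coset g
  ∈-coset⁺ g kq f≈gq = MembershipProperties.∈-resp-≈ S (sym f≈gq)
    (MembershipProperties.∈-map⁺ S S (λ q≈q′ z → ≡.cong g (q≈q′ z)) (K⊆LK _ kq))

  ∈-coset⁻ : ∀ {f} g → f ∈ coset g → ∃ λ q → K q × f ≈ (g ∘ q)
  ∈-coset⁻ g f∈ = let q , q∈LK , f≈gq = MembershipProperties.∈-map⁻ S S f∈ in
    q , lookupₛ S K.resp LK⊆K q∈LK , f≈gq

  coset-unique : ∀ {g⁻¹} g → (g⁻¹ ∘ g) ≈ id → Unique.Unique S LK → Unique.Unique S (coset g)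
  coset-unique {g⁻¹} g g⁻¹g≈id = UniqueProperties.map⁺ S S λ gq≈gq′ z →
    ≡.trans (≡.sym (g⁻¹g≈id _)) (≡.trans (≡.cong g⁻¹ (gq≈gq′ z)) (g⁻¹g≈id _))

  _~_ : Perm m → Perm m → Set
  f ~ g = f ∈ coset g

  ~-isEquivalence : IsEquivalence _~_
  ~-isEquivalence = record
    { refl  = λ {f} → ∈-coset⁺ f K.id-closed (λ _ → ≡.refl)
    ; sym   = λ {f} {g} f~g → let q , kq , f≈gq = ∈-coset⁻ g f~g in
        ∈-coset⁺ f (K.inverse-closed kq) λ z →
          ≡.trans (≡.cong g (≡.sym (K.inverseʳ kq z))) (≡.sym (f≈gq (K.inverse kq z)))
    ; trans = λ {f} {g} {h} f~g g~h → let q , kq , f≈gq = ∈-coset⁻ g f~g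
                                          _ , kq′ , g≈hq′ = ∈-coset⁻ h g~h in
        ∈-coset⁺ h (K.∘-closed kq kq′) λ z → ≡.trans (f≈gq z) (g≈hq′ (q z))
    }

  _~?_ : Decidable _~_
  f ~? g = any? (f ≈?_) (coset g)

  open Counting.Classes S ~-isEquivalence (λ {_} {g} f≈g → ∈-coset⁺ g K.id-closed f≈g) _~?_ public

module _ {m} {H K : Pred (Perm m) 0ℓ} (H-sub : IsSubgroup H) (K-sub : IsSubgroup K) (K⊆H : K ⊆ H) where
  private
    module H = IsSubgroup H-sub
    S = Perm-setoid m
    open Setoid S using (sym)
    open Subset S renaming (_⊆_ to _⊆ₗ_)
    open Counting S

  lagrange : ∀ {h k} → HasSizeP H h → HasSizeP K k → k ∣ h
  lagrange (LH , ≡.refl , LH! , LH⊆H , H⊆LH) (LK , ≡.refl , LK! , LK⊆K , K⊆LK) =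
    classesOfSize⇒∣length LH! classesOfSize
    where
    open LeftCosets K-sub LK LK⊆K K⊆LK

    classesOfSize : ClassesOfSize (length LK) LH
    classesOfSize {g} g∈LH =
      ≡.trans (unique-⊆-⊇⇒length-≡ (class-unique g LH!) (coset-unique {H.inverse hg} g (H.inverseˡ hg) LK!)
                                   narrower wider)
              (length-map (g ∘_) LK)
      where
      hg : H g
      hg = lookupₛ S H.resp LH⊆H g∈LH
      narrower : class g LH ⊆ₗ coset g
      narrower f∈ = proj₂ (∈-class⁻ g LH f∈)
      wider : coset g ⊆ₗ class g LH
      wider f∈ = let q , kq , f≈gq = ∈-coset⁻ g f∈ in
        ∈-class⁺ g LH (H⊆LH _ (H.resp (sym f≈gq) (H.∘-closed (K⊆H kq) hg))) f∈

hasSize-nonZero : ∀ {m} {P : Pred (Perm m) 0ℓ} {k f} → HasSizeP P k → P f → NonZero k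
hasSize-nonZero (_ , ≡.refl , _ , _ , P⊆L) pf = >-nonZero (MembershipProperties.∈-length (Perm-setoid _) (P⊆L _ pf))

∩-size-≤-gcd : ∀ {m} {H₁ H₂ : Pred (Perm m) 0ℓ} {s₁ s₂ b} → IsSubgroup H₁ → IsSubgroup H₂ →
               HasSizeP H₁ s₁ → HasSizeP H₂ s₂ → HasSizeP (H₁ ∩ H₂) b → b ≤ gcd s₁ s₂
∩-size-≤-gcd {s₁ = s₁} {s₂} H₁-sub H₂-sub |H₁| |H₂| |H₁∩H₂| = ∣⇒≤ {{gcd-nonZero}}
  (gcd-greatest (lagrange H₁-sub H₁∩H₂-sub proj₁ |H₁| |H₁∩H₂|)
                (lagrange H₂-sub H₁∩H₂-sub proj₂ |H₂| |H₁∩H₂|))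
  where
  H₁∩H₂-sub = ∩-isSubgroup H₁-sub H₂-sub
  gcd-nonZero : NonZero (gcd s₁ s₂)
  gcd-nonZero = ≢-nonZero (gcd[m,n]≢0 s₁ s₂
    (inj₁ (≢-nonZero⁻¹ s₁ {{hasSize-nonZero |H₁| (IsSubgroup.id-closed H₁-sub)}})))

module _ {m} {H : Pred (Perm m) 0ℓ} (H-sub : IsSubgroup H) (x : Fin m) where
  private
    module H = IsSubgroup H-sub
    S = Perm-setoid m
    open Membership S using (_∈_)
    open Unique S using (Unique)
    open Counting S

  -- Fixing for each point y an element t_y ∈ ds with t_y x = y, every g ∈ ds equals
  -- t_{g x} ∘ s with s = t_{g x}⁻¹ ∘ g ∈ Stab_H(x); so g ↦ (g x , s) is injective.
  orbit-stabiliser-≤ : ∀ {orbit : List (Fin m)} {stab ds : List (Perm m)} →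
                       (∀ {f} → H f → f x ∈ₚ orbit) → (∀ {f} → Stabiliser H x f → f ∈ stab) →
                       Unique ds → All H ds → length ds ≤ length orbit * length stab
  orbit-stabiliser-≤ {orbit} {stab} {ds} orbit-complete stab-complete ds! ds⊆H =
    ≡.subst (length ds ≤_) (length-cartesianProductWith cover-element orbit stab)
      (unique-⊆⇒length-≤ ds! (lookupₛ S (MembershipProperties.∈-resp-≈ S) (All.tabulate ∈-cover)))
    where
    transversal : Fin m → Perm m
    transversal y with any? (λ r → r x ≟ y) ds
    ... | yes r∈ds = Any.lookup r∈ds
    ... | no  _    = id

    transversal-spec : ∀ {y} → Any (λ r → r x ≡ y) ds → H (transversal y) × transversal y x ≡ y
    transversal-spec {y} r∈ds with any? (λ r → r x ≟ y) ds
    ... | yes r′∈ds = lookupAny ds⊆H r′∈ds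
    ... | no  r∉ds  = contradiction r∈ds r∉ds

    cover-element : Fin m → Perm m → Perm m
    cover-element y s = transversal y ∘ s

    ∈-cover : ∀ {g} → g ∈ₚ ds → g ∈ cartesianProductWith cover-element orbit stab
    ∈-cover {g} g∈ds = Any.cartesianProductWith⁺ cover-element g≈ts (orbit-complete hg) (stab-complete s-stabilises)
      where
      hg : H g
      hg = All.lookup ds⊆H g∈ds
      t-spec : H (transversal (g x)) × transversal (g x) x ≡ g x
      t-spec = transversal-spec (Any.map (λ g≡r → ≡.cong (λ r → r x) (≡.sym g≡r)) g∈ds)
      ht : H (transversal (g x))
      ht = proj₁ t-spec
      s : Perm m
      s = H.inverse ht ∘ g
      s-stabilises : Stabiliser H x s
      s-stabilises = H.∘-closed hg (H.inverse-closed ht) ,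
                     ≡.trans (≡.cong (H.inverse ht) (≡.sym (proj₂ t-spec))) (H.inverseˡ ht x)
      g≈ts : ∀ {y s′} → g x ≡ y → s ≈ s′ → g ≈ cover-element y s′
      g≈ts ≡.refl s≈s′ z = ≡.trans (≡.sym (H.inverseʳ ht (g z))) (≡.cong (transversal (g x)) (s≈s′ z))

∁[⁅i⁆∪⁅j⁆]⊆∁⁅i⁆ : ∀ {n} (i j : Fin n) → ∁ (⁅ i ⁆ ∪ ⁅ j ⁆) ⊆ₛ ∁ ⁅ i ⁆
∁[⁅i⁆∪⁅j⁆]⊆∁⁅i⁆ i j = p⊆q⇒∁p⊇∁q (p⊆p∪q ⁅ j ⁆)

∁[⁅i⁆∪⁅j⁆]⊆∁⁅j⁆ : ∀ {n} (i j : Fin n) → ∁ (⁅ i ⁆ ∪ ⁅ j ⁆) ⊆ₛ ∁ ⁅ j ⁆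
∁[⁅i⁆∪⁅j⁆]⊆∁⁅j⁆ i j = p⊆q⇒∁p⊇∁q (q⊆p∪q ⁅ i ⁆ ⁅ j ⁆)

full⊎⊆∁⁅⁆ : ∀ {n} (p : Subset n) → (∀ x → x ∈ₛ p) ⊎ ∃ λ i → p ⊆ₛ ∁ ⁅ i ⁆
full⊎⊆∁⁅⁆ p with Fin.any? (λ i → ¬? (i ∈? p))
... | yes (i , i∉p) = inj₂ (i , λ x∈p → x∉p⇒x∈∁p λ x∈⁅i⁆ →
                        i∉p (≡.subst (_∈ₛ p) (x∈⁅y⁆⇒x≡y _ x∈⁅i⁆) x∈p))
... | no  ∄i∉p      = inj₁ λ x → decidable-stable (x ∈? p) λ x∉p → ∄i∉p (x , x∉p)

module _ {n m} (X : ProperEdgeColouredGraph n m) where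
  open ProperEdgeColouredGraph X
  private
    S = Perm-setoid m
    open Unique S using (Unique)
    open Counting S

  word-++ : ∀ u v → word X (u ++ v) ≈ (word X v ∘ word X u)
  word-++ []      v z = ≡.refl
  word-++ (k ∷ u) v z = word-++ u v (ρ k z)

  word-reverse-inverseˡ : ∀ w → (word X (reverse w) ∘ word X w) ≈ id
  word-reverse-inverseˡ []      z = ≡.refl
  word-reverse-inverseˡ (k ∷ w) z = begin
    word X (reverse (k ∷ w)) (word X w (ρ k z))
      ≡⟨ ≡.cong (λ u → word X u (word X w (ρ k z))) (unfold-reverse k w) ⟩
    word X (reverse w ++ k ∷ []) (word X w (ρ k z))
      ≡⟨ word-++ (reverse w) (k ∷ []) _ ⟩
    ρ k (word X (reverse w) (word X w (ρ k z)))
      ≡⟨ ≡.cong (ρ k) (word-reverse-inverseˡ w (ρ k z)) ⟩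
    ρ k (ρ k z)
      ≡⟨ invol k z ⟩
    z ∎
    where open ≡.≡-Reasoning

  word-reverse-inverseʳ : ∀ w → (word X w ∘ word X (reverse w)) ≈ id
  word-reverse-inverseʳ w z =
    ≡.trans (≡.cong (λ u → word X u (word X (reverse w) z)) (≡.sym (reverse-involutive w)))
            (word-reverse-inverseˡ (reverse w) z)

  InGen-isSubgroup : ∀ J → IsSubgroup (InGen X J)
  InGen-isSubgroup J = record
    { resp           = λ f≈g (w , w⊆J , f≈w) → w , w⊆J , λ z → ≡.trans (≡.sym (f≈g z)) (f≈w z)
    ; id-closed      = [] , [] , λ _ → ≡.refl
    ; ∘-closed       = λ {f} (u , u⊆J , f≈u) (v , v⊆J , g≈v) → u ++ v , All.++⁺ u⊆J v⊆J ,
        λ z → ≡.trans (g≈v (f z)) (≡.trans (≡.cong (word X v) (f≈u z)) (≡.sym (word-++ u v z)))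
    ; inverse        = λ (w , _) → word X (reverse w)
    ; inverse-closed = λ (w , w⊆J , _) →
        reverse w , All.tabulate (λ k∈rev → All.lookup w⊆J (Any.reverse⁻ k∈rev)) , λ _ → ≡.refl
    ; inverseˡ       = λ (w , _ , f≈w) z → ≡.trans (≡.cong (word X (reverse w)) (f≈w z)) (word-reverse-inverseˡ w z)
    ; inverseʳ       = λ (w , _ , f≈w) z → ≡.trans (f≈w _) (word-reverse-inverseʳ w z)
    }

  InStab-isSubgroup : ∀ J x → IsSubgroup (InStab X J x)
  InStab-isSubgroup J = stabiliser-isSubgroup (InGen-isSubgroup J)

  InGen-mono : ∀ {J K} → J ⊆ₛ K → InGen X J ⊆ InGen X K
  InGen-mono J⊆K (w , w⊆J , f≈w) = w , All.map J⊆K w⊆J , f≈w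

  Gᵢ∩Gⱼ⊆Gᵢⱼ : ∀ i j → (∃ λ x → Condition X i j x) →
              (InGen X (Iminus X i) ∩ InGen X (Iminus X j)) ⊆ InGen X (Iminus2 X i j)
  Gᵢ∩Gⱼ⊆Gᵢⱼ i j (x , _ , _ , _ , (orbit , ≡.refl , _ , _ , orbit-complete) ,
                                 (stab , ≡.refl , _ , _ , stab-complete) ,
                                 (Gᵢⱼ , ≡.refl , Gᵢⱼ! , Gᵢⱼ⊆ , _) , ab≤c) =
    lookupₛ S (IsSubgroup.resp (InGen-isSubgroup _)) Gᵢⱼ⊆
      ∘ unique-maximal⇒complete _≈?_ Gᵢⱼ! Gᵢⱼ⊆H maximal
    where
    H : Pred (Perm m) 0ℓ
    H = InGen X (Iminus X i) ∩ InGen X (Iminus X j)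
    Gᵢⱼ⊆H : All H Gᵢⱼ
    Gᵢⱼ⊆H = All.map (λ g → InGen-mono (∁[⁅i⁆∪⁅j⁆]⊆∁⁅i⁆ i j) g , InGen-mono (∁[⁅i⁆∪⁅j⁆]⊆∁⁅j⁆ i j) g)
                    Gᵢⱼ⊆
    maximal : ∀ {ds} → Unique ds → All H ds → length ds ≤ length Gᵢⱼ
    maximal ds! ds⊆H =
      ≤-trans (orbit-stabiliser-≤ (∩-isSubgroup (InGen-isSubgroup (Iminus X i)) (InGen-isSubgroup (Iminus X j))) x
                (λ {f} (fᵢ , fⱼ) → orbit-complete (f x) ((f , fᵢ , ≡.refl) , (f , fⱼ , ≡.refl)))
                (λ {f} ((fᵢ , fⱼ) , fx≡x) → stab-complete f ((fᵢ , fx≡x) , (fⱼ , fx≡x)))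
                ds! ds⊆H)
              ab≤c

  intersectionProperty : (∀ i → IntersectionProperty X (Iminus X i)) → (∀ i j → ∃ λ x → Condition X i j x) →
                         IntersectionProperty X ⊤
  intersectionProperty IPᵢ cond J K _ _ f f∈G_J f∈G_K with full⊎⊆∁⁅⁆ J | full⊎⊆∁⁅⁆ K
  ... | inj₁ J-full | _           = InGen-mono (λ k∈K → x∈p∩q⁺ (J-full _ , k∈K)) f∈G_K
  ... | inj₂ _      | inj₁ K-full = InGen-mono (λ k∈J → x∈p∩q⁺ (k∈J , K-full _)) f∈G_J
  ... | inj₂ (i , J⊆I∖i) | inj₂ (j , K⊆I∖j) =
    InGen-mono (λ k∈ → x∈p∩q⁺ (p∩q⊆p _ _ (p∩q⊆p _ _ k∈) , p∩q⊆q _ _ k∈)) f∈G_[J∩Iᵢⱼ]∩K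
    where
    f∈Gᵢⱼ : InGen X (Iminus2 X i j) f
    f∈Gᵢⱼ = Gᵢ∩Gⱼ⊆Gᵢⱼ i j (cond i j) (InGen-mono J⊆I∖i f∈G_J , InGen-mono K⊆I∖j f∈G_K)
    f∈G_J∩Iᵢⱼ : InGen X (J ∩ₛ Iminus2 X i j) f
    f∈G_J∩Iᵢⱼ = IPᵢ i J (Iminus2 X i j) J⊆I∖i (∁[⁅i⁆∪⁅j⁆]⊆∁⁅i⁆ i j) f f∈G_J f∈Gᵢⱼ
    f∈G_[J∩Iᵢⱼ]∩K : InGen X ((J ∩ₛ Iminus2 X i j) ∩ₛ K) f
    f∈G_[J∩Iᵢⱼ]∩K = IPᵢ j (J ∩ₛ Iminus2 X i j) K (∁[⁅i⁆∪⁅j⁆]⊆∁⁅j⁆ i j ∘ p∩q⊆q _ _) K⊆I∖j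
                        f f∈G_J∩Iᵢⱼ f∈G_K

lemma4p3 : ∀ {n m} (X : ProperEdgeColouredGraph n m) →
    ((∀ i → IntersectionProperty X (Iminus X i)) →
     (∀ i j → ∃ λ x → Condition X i j x) →
     IntersectionProperty X ⊤)
    ×
    (∀ i j x (a si sj b c : ℕ) →
     HasSizeV (OrbitInter X i j x) a →
     HasSizeP (InStab X (Iminus X i) x) si →
     HasSizeP (InStab X (Iminus X j) x) sj →
     HasSizeP (StabInter X i j x) b →
     HasSizeP (InGen X (Iminus2 X i j)) c →
     a * gcd si sj ≤ c → a * b ≤ c)
lemma4p3 X = intersectionProperty X , λ i j x a _ _ _ _ _ |Stabᵢ| |Stabⱼ| |Stabᵢ∩Stabⱼ| _ a*gcd≤c →
  ≤-trans (*-monoʳ-≤ a (∩-size-≤-gcd (InStab-isSubgroup X _ x) (InStab-isSubgroup X _ x)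
                                     |Stabᵢ| |Stabⱼ| |Stabᵢ∩Stabⱼ|))
          a*gcd≤c
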